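{- Let $n=p+q$ and $\Sigma\in T_n$. Let $A=st(\Sigma\mid\{1,\ldots,p\})$ and $B=st(\Sigma\mid\{p+1,\ldots,n\})$. Then for all $U\in T_p$ and $V\in T_q$, one has $\Sigma\leq V\bigtriangleup U$ if and only if $A\leq U$ and $B\leq V$, where $\leq$ is the Taskin weak order.
   Context: $T_m$ is the set of standard Young tableaux with entries $1,\ldots,m$; $P(\sigma)$ is the Robinson–Schensted insertion tableau of a permutation $\sigma$. Permutations are words; the right weak order on $S_m$ is inclusion of inversion sets (an inversion is a pair $(j,i)$, $j>i$, $j$ to the left of $i$). The Taskin weak order on $T_m$ is the transitive closure of: $U\leq V$ if there are $u\leq v$ in $S_m$ with $P(u)=U$, $P(v)=V$. For $\sigma\in S_m$, $I\subseteq\{1,\ldots,m\}$, $\sigma\mid I$ is the word obtained by deleting letters not in $I$; $st$ is standardization (increasing relabelling onto $\{1,\ldots,k\}$). For a tableau $\Sigma=P(\sigma)$ and an interval $I$, $st(\Sigma\mid I):=P(st(\sigma\mid I))$ (independent of the choice of $\sigma$). For $u\in S_p$, $v\in S_q$, $v\bigtriangleup u=\bar v u$ (concatenation), $\bar v$ being $v$ with $p$ added to each letter; for $U\in T_p$, $V\in T_q$, $V\bigtriangleup U:=P(v\bigtriangleup u)$ for any $u,v$ with $P(u)=U$, $P(v)=V$ (well defined). -}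

module Defs where

open import Data.Nat using (ℕ; zero; suc; _+_; _<_; _≤_; _<?_; _≤?_)
open import Data.List using (List; []; _∷_; _++_; map; filter; length; concat; upTo; foldl)
open import Data.List.Membership.Propositional using (_∈_)
open import Data.List.Relation.Unary.All using (All)
open import Data.List.Relation.Unary.Linked using (Linked)
open import Data.List.Relation.Binary.Permutation.Propositional using (_↭_)
open import Data.Maybe using (Maybe; just; nothing)
open import Data.Product using (Σ; _×_; _,_; ∃)
open import Relation.Nullary using (¬_)
open import Relation.Nullary.Decidable using (_×-dec_)
open import Relation.Binary.PropositionalEquality using (_≡_)
open import Relation.Binary.Construct.Closure.Transitive using (TransClosure)

-- Permutations of {1,…,m}, written as words (one-line notation).

Word : Set
Word = List ℕ

IsPerm : ℕ → Word → Set
IsPerm m w = w ↭ map suc (upTo m)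

data Before : Word → ℕ → ℕ → Set where
  here  : ∀ {x y w} → y ∈ w → Before (x ∷ w) x y
  there : ∀ {z x y w} → Before w x y → Before (z ∷ w) x y

Inversion : Word → ℕ → ℕ → Set
Inversion w j i = i < j × Before w j i

-- right weak order: inclusion of inversion sets
WeakLe : Word → Word → Set
WeakLe u v = ∀ j i → Inversion u j i → Inversion v j i

-- Tableaux (English notation, list of rows, top row first)

Tableau : Set
Tableau = List (List ℕ)

data RowBelow : List ℕ → List ℕ → Set where
  done : ∀ {r} → RowBelow r []
  step : ∀ {x y r r'} → x < y → RowBelow r r' → RowBelow (x ∷ r) (y ∷ r')

IsSYT : ℕ → Tableau → Set
IsSYT m T =
  All (λ r → ¬ (r ≡ [])) T ×
  All (Linked _<_) T ×
  Linked RowBelow T ×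
  concat T ↭ map suc (upTo m)

rowIns : ℕ → List ℕ → Maybe ℕ × List ℕ
rowIns x [] = nothing , (x ∷ [])
rowIns x (y ∷ r) with x <? y
... | Relation.Nullary.yes _ = just y , (x ∷ r)
... | Relation.Nullary.no _ with rowIns x r
...   | (b , r') = b , (y ∷ r')

insertT : ℕ → Tableau → Tableau
insertT x [] = (x ∷ []) ∷ []
insertT x (r ∷ rs) with rowIns x r
... | (nothing , r') = r' ∷ rs
... | (just y , r') = r' ∷ insertT y rs

P : Word → Tableau
P w = foldl (λ T x → insertT x T) [] w

TaskinStep : ℕ → Tableau → Tableau → Set
TaskinStep m U V =
  Σ Word λ u → Σ Word λ v →
    IsPerm m u × IsPerm m v × WeakLe u v × P u ≡ U × P v ≡ V

TaskinLe : ℕ → Tableau → Tableau → Set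
TaskinLe m = TransClosure (TaskinStep m)

restrict : ℕ → ℕ → Word → Word
restrict a b = filter (λ x → (a ≤? x) ×-dec (x ≤? b))

st : Word → Word
st w = map (λ x → suc (length (filter (λ y → y <? x) w))) w

shiftW : ℕ → Word → Word
shiftW p = map (p +_)

triangle : ℕ → Word → Word → Word
triangle p v u = shiftW p v ++ u

module Submission where

-- Two words have the same insertion tableau iff they are Knuth equivalent (Knuth's theorem,
-- via the reading word). Restricting to an interval of letters, standardizing, and each
-- argument of △ respect Knuth equivalence and are monotone for the weak order, so they carry
-- Taskin chains to Taskin chains; restricting a chain from Σ to V △ U gives A ≤ U and B ≤ V.
-- Conversely, moving the letters p+1, …, n of σ in front of 1, …, p goes up in the weak order
-- and yields b △ a with P a = A and P b = B, so Σ ≤ B △ A ≤ B △ U ≤ V △ U.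

open import Defs
open import Function.Bundles using (_⇔_; mk⇔)
open import Data.Nat using (ℕ; zero; suc; _+_; _∸_; _<_; _≤_; z≤n; s≤s)
open import Data.Nat.Properties
open import Data.List using (List; []; _∷_; _++_; [_]; map; filter; length; foldl; upTo; applyUpTo; fromMaybe)
open import Data.List.Properties
  using (++-assoc; ++-identityʳ; foldl-++; map-++; filter-++; filter-accept; filter-reject; filter-all; filter-none;
         map-cong; map-cong-local; map-∘; map-id; map-id-local; map-upTo)
open import Data.List.Relation.Unary.All.Properties using (++⁻ˡ; ++⁻ʳ)
open import Data.List.Relation.Binary.Permutation.Propositional
  using (_↭_; ↭-refl; ↭-sym; ↭-trans; ↭-reflexive; ↭-isEquivalence; prep; swap)
import Data.List.Relation.Binary.Permutation.Propositional as ↭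
open import Data.List.Relation.Binary.Permutation.Propositional.Properties
  using (All-resp-↭; ∈-resp-↭; ↭-length; ++⁺ˡ; ++⁺ʳ; ++⁺; ++-comm; filter-↭; map⁺)
open import Data.List.Membership.Propositional using (_∈_)
open import Data.List.Membership.Propositional.Properties
  using (∈-++⁺ˡ; ∈-++⁺ʳ; ∈-++⁻; ∈-map⁺; ∈-map⁻; ∈-filter⁺; ∈-filter⁻)
open import Data.List.Relation.Unary.Any using (here; there)
open import Data.List.Relation.Unary.All as All using (All; []; _∷_)
open import Data.List.Relation.Unary.AllPairs using (AllPairs; []; _∷_)
open import Data.Maybe using (Maybe; just; nothing)
open import Data.Maybe.Properties using (just-injective)
open import Data.Product using (_×_; _,_; ∃; proj₁; proj₂; map₁)
open import Data.Sum using (_⊎_; inj₁; inj₂)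
open import Data.Empty using (⊥-elim)
open import Data.Unit using (⊤; tt)
open import Function using (id; _∘_)
open import Relation.Unary using (Decidable)
open import Relation.Nullary using (¬_; yes; no)
open import Relation.Nullary.Decidable using (_×-dec_)
open import Relation.Binary.PropositionalEquality hiding ([_])
open import Relation.Binary.PropositionalEquality.Properties as ≡ using ()
open import Relation.Binary.Construct.Closure.Equivalence using (EqClosure; symmetric; gmap; fold; gfold; return)
open import Relation.Binary.Construct.Closure.ReflexiveTransitive using (ε; _◅_; _◅◅_)
open import Relation.Binary.Construct.Closure.Symmetric using (fwd; bwd)
import Relation.Binary.Construct.Closure.Transitive as TC
open TC using (_∷_) renaming (_++_ to _⁺++_)

bumped : ℕ → List ℕ → Maybe ℕ
bumped x r = proj₁ (rowIns x r)

newRow : ℕ → List ℕ → List ℕ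
newRow x r = proj₂ (rowIns x r)

Sorted : List ℕ → Set
Sorted = AllPairs _≤_

rowIns-< : ∀ {x y} r → x < y → rowIns x (y ∷ r) ≡ (just y , x ∷ r)
rowIns-< {x} {y} r x<y with x <? y
... | yes _ = refl
... | no x≮y = ⊥-elim (x≮y x<y)

rowIns-≮ : ∀ {x y} r → ¬ x < y → rowIns x (y ∷ r) ≡ (bumped x r , y ∷ newRow x r)
rowIns-≮ {x} {y} r x≮y with x <? y
... | yes x<y = ⊥-elim (x≮y x<y)
... | no _ = refl

data RowInsView (x y : ℕ) (r : List ℕ) : Set where
  bumps  : x < y → rowIns x (y ∷ r) ≡ (just y , x ∷ r) → RowInsView x y r
  passes : ¬ x < y → rowIns x (y ∷ r) ≡ (bumped x r , y ∷ newRow x r) → RowInsView x y r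

rowInsView : ∀ x y r → RowInsView x y r
rowInsView x y r with x <? y
... | yes x<y = bumps x<y (rowIns-< r x<y)
... | no x≮y = passes x≮y (rowIns-≮ r x≮y)

bumped-just⁻ : ∀ x r {b} → bumped x r ≡ just b → b ∈ r × x < b
bumped-just⁻ x (y ∷ r) eq with rowInsView x y r
... | bumps x<y e rewrite e | just-injective eq = here refl , x<y
... | passes _ e rewrite e with bumped-just⁻ x r eq
...   | b∈r , x<b = there b∈r , x<b

bumped-nothing⁻ : ∀ x r → bumped x r ≡ nothing → All (λ e → ¬ x < e) r
bumped-nothing⁻ x [] _ = []
bumped-nothing⁻ x (y ∷ r) eq with rowInsView x y r
... | bumps _ e rewrite e with eq
...   | ()
bumped-nothing⁻ x (y ∷ r) eq | passes x≮y e rewrite e = x≮y ∷ bumped-nothing⁻ x r eq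

bumped-just⁺ : ∀ x r {e} → e ∈ r → x < e → ∃ λ b → bumped x r ≡ just b
bumped-just⁺ x (y ∷ r) e∈r x<e with rowInsView x y r
... | bumps _ e rewrite e = y , refl
... | passes x≮y e rewrite e with e∈r
...   | here refl = ⊥-elim (x≮y x<e)
...   | there e∈r′ = bumped-just⁺ x r e∈r′ x<e

bumped-minimal : ∀ x r {b e} → Sorted r → bumped x r ≡ just b → e ∈ r → x < e → b ≤ e
bumped-minimal x (y ∷ r) (y≤r ∷ _) eq e∈r x<e with rowInsView x y r
... | bumps _ e rewrite e | sym (just-injective eq) with e∈r
...   | here refl = ≤-refl
...   | there e∈r′ = All.lookup y≤r e∈r′
bumped-minimal x (y ∷ r) (_ ∷ sr) eq e∈r x<e | passes x≮y e rewrite e with e∈r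
...   | here refl = ⊥-elim (x≮y x<e)
...   | there e∈r′ = bumped-minimal x r sr eq e∈r′ x<e

∈-newRow⁻ : ∀ x r {e} → e ∈ newRow x r → e ∈ r ⊎ e ≡ x
∈-newRow⁻ x [] (here refl) = inj₂ refl
∈-newRow⁻ x (y ∷ r) e∈ with rowInsView x y r
... | bumps _ e rewrite e with e∈
...   | here refl = inj₂ refl
...   | there e∈r = inj₁ (there e∈r)
∈-newRow⁻ x (y ∷ r) e∈ | passes _ e rewrite e with e∈
...   | here refl = inj₁ (here refl)
...   | there e∈′ with ∈-newRow⁻ x r e∈′
...     | inj₁ e∈r = inj₁ (there e∈r)
...     | inj₂ e≡x = inj₂ e≡x

x∈newRow : ∀ x r → x ∈ newRow x r
x∈newRow x [] = here refl
x∈newRow x (y ∷ r) with rowInsView x y r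
... | bumps _ e rewrite e = here refl
... | passes _ e rewrite e = there (x∈newRow x r)

newRow-nothing : ∀ x r → bumped x r ≡ nothing → newRow x r ≡ r ++ [ x ]
newRow-nothing x [] _ = refl
newRow-nothing x (y ∷ r) eq with rowInsView x y r
... | bumps _ e rewrite e with eq
...   | ()
newRow-nothing x (y ∷ r) eq | passes _ e rewrite e = cong (y ∷_) (newRow-nothing x r eq)

newRow-sorted : ∀ x r → Sorted r → Sorted (newRow x r)
newRow-sorted x [] _ = [] ∷ []
newRow-sorted x (y ∷ r) (y≤r ∷ sr) with rowInsView x y r
... | bumps x<y e rewrite e = All.map (≤-trans (<⇒≤ x<y)) y≤r ∷ sr
... | passes x≮y e rewrite e = All.tabulate y≤ ∷ newRow-sorted x r sr
  where
  y≤ : ∀ {c} → c ∈ newRow x r → y ≤ c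
  y≤ c∈ with ∈-newRow⁻ x r c∈
  ... | inj₁ c∈r = All.lookup y≤r c∈r
  ... | inj₂ refl = ≮⇒≥ x≮y

newRow-head : ∀ x r → ∃ λ c → ∃ λ rest → newRow x r ≡ c ∷ rest × c ≤ x
newRow-head x [] = x , [] , refl , ≤-refl
newRow-head x (y ∷ r) with rowInsView x y r
... | bumps _ e rewrite e = x , r , refl , ≤-refl
... | passes x≮y e rewrite e = y , newRow x r , refl , ≮⇒≥ x≮y

rowInsWord : List ℕ → List ℕ → List ℕ × List ℕ
rowInsWord [] r = r , []
rowInsWord (x ∷ w) r =
  proj₁ (rowInsWord w (newRow x r)) , fromMaybe (bumped x r) ++ proj₂ (rowInsWord w (newRow x r))

insertWord : List ℕ → Tableau → Tableau
insertWord w T = foldl (λ T x → insertT x T) T w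

insertT-∷ : ∀ x r rs → insertT x (r ∷ rs) ≡ newRow x r ∷ insertWord (fromMaybe (bumped x r)) rs
insertT-∷ x r rs with rowIns x r
... | nothing , _ = refl
... | just _ , _ = refl

insertWord-∷ : ∀ w r rs →
  insertWord w (r ∷ rs) ≡ proj₁ (rowInsWord w r) ∷ insertWord (proj₂ (rowInsWord w r)) rs
insertWord-∷ [] r rs = refl
insertWord-∷ (x ∷ w) r rs = begin
  insertWord w (insertT x (r ∷ rs))
    ≡⟨ cong (insertWord w) (insertT-∷ x r rs) ⟩
  insertWord w (newRow x r ∷ insertWord b rs)
    ≡⟨ insertWord-∷ w (newRow x r) (insertWord b rs) ⟩
  proj₁ (rowInsWord w (newRow x r)) ∷ insertWord (proj₂ (rowInsWord w (newRow x r))) (insertWord b rs)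
    ≡⟨ cong (proj₁ (rowInsWord w (newRow x r)) ∷_)
            (sym (foldl-++ (λ T x → insertT x T) rs b (proj₂ (rowInsWord w (newRow x r))))) ⟩
  proj₁ (rowInsWord (x ∷ w) r) ∷ insertWord (proj₂ (rowInsWord (x ∷ w) r)) rs ∎
  where
  open ≡-Reasoning
  b = fromMaybe (bumped x r)

P-++ : ∀ u v → P (u ++ v) ≡ insertWord v (P u)
P-++ u v = foldl-++ (λ T x → insertT x T) [] u v

insertT-sorted : ∀ x T → All Sorted T → All Sorted (insertT x T)
insertT-sorted x [] _ = ([] ∷ []) ∷ []
insertT-sorted x (r ∷ rs) (sr ∷ srs) rewrite insertT-∷ x r rs =
  newRow-sorted x r sr ∷ below (bumped x r)
  where
  below : ∀ b → All Sorted (insertWord (fromMaybe b) rs)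
  below nothing = srs
  below (just y) = insertT-sorted y rs srs

insertWord-sorted : ∀ w T → All Sorted T → All Sorted (insertWord w T)
insertWord-sorted [] T sT = sT
insertWord-sorted (x ∷ w) T sT = insertWord-sorted w (insertT x T) (insertT-sorted x T sT)

P-sorted : ∀ w → All Sorted (P w)
P-sorted w = insertWord-sorted w [] []

-- Knuth moves commute with insertion

-- The reflexive case is included because inserting Knuth-related words may bump identical words.
data KnuthMove : List ℕ → List ℕ → Set where
  stay   : ∀ {w} → KnuthMove w w
  knuth₁ : ∀ {x y z} → x < y → y ≤ z → KnuthMove (y ∷ z ∷ x ∷ []) (y ∷ x ∷ z ∷ [])
  knuth₂ : ∀ {x y z} → x ≤ y → y < z → KnuthMove (x ∷ z ∷ y ∷ []) (z ∷ x ∷ y ∷ [])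

RowInsKnuth : List ℕ → List ℕ → List ℕ → Set
RowInsKnuth w w′ r =
  proj₁ (rowInsWord w r) ≡ proj₁ (rowInsWord w′ r) ×
  KnuthMove (proj₂ (rowInsWord w r)) (proj₂ (rowInsWord w′ r))

rowInsWord-pass : ∀ a w r → All (λ c → ¬ c < a) w →
  rowInsWord w (a ∷ r) ≡ (a ∷ proj₁ (rowInsWord w r) , proj₂ (rowInsWord w r))
rowInsWord-pass a [] r _ = refl
rowInsWord-pass a (c ∷ w) r (c≮a ∷ w≮a)
  rewrite rowIns-≮ r c≮a | rowInsWord-pass a w (newRow c r) w≮a = refl

rowIns-knuth₁-[] : ∀ {x y z} → x < y → y ≤ z →
  rowInsWord (y ∷ z ∷ x ∷ []) [] ≡ rowInsWord (y ∷ x ∷ z ∷ []) []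
rowIns-knuth₁-[] {x} {y} {z} x<y y≤z
  rewrite rowIns-≮ {z} {y} [] (≤⇒≯ y≤z) | rowIns-< {x} {y} (z ∷ []) x<y
        | rowIns-< {x} {y} [] x<y | rowIns-≮ {z} {x} [] (<⇒≯ (<-≤-trans x<y y≤z))
  = refl

rowIns-knuth₁-∷ : ∀ {x y z a} r → x < y → y ≤ z → x < a → Sorted (a ∷ r) →
  RowInsKnuth (y ∷ z ∷ x ∷ []) (y ∷ x ∷ z ∷ []) (a ∷ r)
rowIns-knuth₁-∷ {x} {y} {z} {a} r x<y y≤z x<a (a≤r ∷ sr) with rowInsView y a r
... | bumps y<a _
  rewrite rowIns-< {y} {a} r y<a | rowIns-≮ {z} {y} r (≤⇒≯ y≤z)
        | rowIns-< {x} {y} (newRow z r) x<y | rowIns-< {x} {y} r x<y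
        | rowIns-≮ {z} {x} r (<⇒≯ (<-≤-trans x<y y≤z))
  = refl , move
  where
  move : KnuthMove (a ∷ fromMaybe (bumped z r) ++ [ y ]) (a ∷ y ∷ fromMaybe (bumped z r) ++ [])
  move with bumped z r in eb
  ... | nothing = stay
  ... | just b = knuth₁ y<a (All.lookup a≤r (proj₁ (bumped-just⁻ z r eb)))
... | passes y≮a _
  rewrite rowIns-≮ {y} {a} r y≮a | rowIns-≮ {z} {a} (newRow y r) (λ z<a → y≮a (≤-<-trans y≤z z<a))
        | rowIns-< {x} {a} (newRow z (newRow y r)) x<a | rowIns-< {x} {a} (newRow y r) x<a
        | rowIns-≮ {z} {x} (newRow y r) (<⇒≯ (<-≤-trans x<y y≤z))
  = refl , move
  where
  move : KnuthMove (fromMaybe (bumped y r) ++ fromMaybe (bumped z (newRow y r)) ++ [ a ])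
                   (fromMaybe (bumped y r) ++ a ∷ fromMaybe (bumped z (newRow y r)) ++ [])
  move with bumped y r in eb₁ | bumped z (newRow y r) in eb₂
  ... | nothing | nothing = stay
  ... | just _ | nothing = stay
  ... | _ | just d with bumped-just⁻ z (newRow y r) eb₂
  ...   | d∈ , z<d with ∈-newRow⁻ y r d∈
  ...     | inj₂ refl = ⊥-elim (≤⇒≯ y≤z z<d)
  move | nothing | just d | d∈ , z<d | inj₁ d∈r =
    ⊥-elim (All.lookup (bumped-nothing⁻ y r eb₁) d∈r (≤-<-trans y≤z z<d))
  move | just c | just d | d∈ , z<d | inj₁ d∈r =
    knuth₁ (≤-<-trans (≮⇒≥ y≮a) (proj₂ (bumped-just⁻ y r eb₁)))
           (bumped-minimal y r sr eb₁ d∈r (≤-<-trans y≤z z<d))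

rowIns-knuth₂-[] : ∀ {x y z} → x ≤ y → y < z →
  rowInsWord (x ∷ z ∷ y ∷ []) [] ≡ rowInsWord (z ∷ x ∷ y ∷ []) []
rowIns-knuth₂-[] {x} {y} {z} x≤y y<z
  rewrite rowIns-≮ {z} {x} [] (<⇒≯ (≤-<-trans x≤y y<z)) | rowIns-≮ {y} {x} (z ∷ []) (≤⇒≯ x≤y)
        | rowIns-< {y} {z} [] y<z | rowIns-< {x} {z} [] (≤-<-trans x≤y y<z)
        | rowIns-≮ {y} {x} [] (≤⇒≯ x≤y)
  = refl

rowIns-knuth₂-below : ∀ {y z a} → z < a → y < z → ∀ r → All (a ≤_) r →
  newRow y (newRow z r) ≡ newRow y r ×
  KnuthMove (a ∷ fromMaybe (bumped z r) ++ fromMaybe (bumped y (newRow z r)) ++ [])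
            (a ∷ z ∷ fromMaybe (bumped y r) ++ [])
rowIns-knuth₂-below {y} {z} z<a y<z [] _ rewrite rowIns-< {y} {z} [] y<z = refl , stay
rowIns-knuth₂-below {y} {z} z<a y<z (c ∷ r) (a≤c ∷ _)
  rewrite rowIns-< {z} {c} r (<-≤-trans z<a a≤c) | rowIns-< {y} {z} r y<z
        | rowIns-< {y} {c} r (<-trans y<z (<-≤-trans z<a a≤c))
  = refl , knuth₁ z<a a≤c

rowIns-knuth₂-∷ : ∀ {x y z a} r → x ≤ y → y < z → x < a → Sorted (a ∷ r) →
  RowInsKnuth (x ∷ z ∷ y ∷ []) (z ∷ x ∷ y ∷ []) (a ∷ r)
rowIns-knuth₂-∷ {x} {y} {z} {a} r x≤y y<z x<a (a≤r ∷ sr) with rowInsView z a r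
... | bumps z<a _
  rewrite rowIns-< {x} {a} r x<a | rowIns-≮ {z} {x} r (<⇒≯ (≤-<-trans x≤y y<z))
        | rowIns-≮ {y} {x} (newRow z r) (≤⇒≯ x≤y)
        | rowIns-< {z} {a} r z<a | rowIns-< {x} {z} r (≤-<-trans x≤y y<z)
        | rowIns-≮ {y} {x} r (≤⇒≯ x≤y)
  = map₁ (cong (x ∷_)) (rowIns-knuth₂-below z<a y<z r a≤r)
... | passes z≮a _
  rewrite rowIns-< {x} {a} r x<a | rowIns-≮ {z} {x} r (<⇒≯ (≤-<-trans x≤y y<z))
        | rowIns-≮ {y} {x} (newRow z r) (≤⇒≯ x≤y)
        | rowIns-≮ {z} {a} r z≮a | rowIns-< {x} {a} (newRow z r) x<a
        | rowIns-≮ {y} {x} (newRow z r) (≤⇒≯ x≤y)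
  = refl , move
  where
  move : KnuthMove (a ∷ fromMaybe (bumped z r) ++ fromMaybe (bumped y (newRow z r)) ++ [])
                   (fromMaybe (bumped z r) ++ a ∷ fromMaybe (bumped y (newRow z r)) ++ [])
  move with bumped z r in eb₁ | bumped y (newRow z r) in eb₂
  ... | nothing | _ = stay
  ... | just c | nothing with bumped-just⁺ y (newRow z r) (x∈newRow z r) y<z
  ...   | _ , eb rewrite eb with eb₂
  ...     | ()
  move | just c | just d = knuth₂ a≤d (≤-<-trans d≤z (proj₂ (bumped-just⁻ z r eb₁)))
    where
    d≤z : d ≤ z
    d≤z = bumped-minimal y (newRow z r) (newRow-sorted z r sr) eb₂ (x∈newRow z r) y<z
    a≤d : a ≤ d
    a≤d with ∈-newRow⁻ z r (proj₁ (bumped-just⁻ y (newRow z r) eb₂))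
    ... | inj₁ d∈r = All.lookup a≤r d∈r
    ... | inj₂ refl = ≮⇒≥ z≮a

rowInsWord-knuth-[] : ∀ {w w′} → KnuthMove w w′ → rowInsWord w [] ≡ rowInsWord w′ []
rowInsWord-knuth-[] stay = refl
rowInsWord-knuth-[] (knuth₁ x<y y≤z) = rowIns-knuth₁-[] x<y y≤z
rowInsWord-knuth-[] (knuth₂ x≤y y<z) = rowIns-knuth₂-[] x≤y y<z

rowInsWord-knuth : ∀ {w w′} r → Sorted r → KnuthMove w w′ → RowInsKnuth w w′ r

rowInsWord-knuth-pass : ∀ {w w′} a r → Sorted r → KnuthMove w w′ →
  All (λ c → ¬ c < a) w → All (λ c → ¬ c < a) w′ → RowInsKnuth w w′ (a ∷ r)
rowInsWord-knuth-pass {w} {w′} a r sr m w≮a w′≮a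
  rewrite rowInsWord-pass a w r w≮a | rowInsWord-pass a w′ r w′≮a
  with rowInsWord-knuth r sr m
... | same-row , bumped-move = cong (a ∷_) same-row , bumped-move

rowInsWord-knuth r _ stay = refl , stay
rowInsWord-knuth {w} [] _ m =
  cong proj₁ e , subst (λ t → KnuthMove (proj₂ (rowInsWord w [])) (proj₂ t)) e stay
  where e = rowInsWord-knuth-[] m
rowInsWord-knuth (a ∷ r) (a≤r ∷ sr) (knuth₁ {x} {y} {z} x<y y≤z) with rowInsView x a r
... | bumps x<a _ = rowIns-knuth₁-∷ r x<y y≤z x<a (a≤r ∷ sr)
... | passes x≮a _ =
  rowInsWord-knuth-pass a r sr (knuth₁ x<y y≤z) (y≮a ∷ z≮a ∷ x≮a ∷ []) (y≮a ∷ x≮a ∷ z≮a ∷ [])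
  where
  y≮a = ≤⇒≯ (≤-trans (≮⇒≥ x≮a) (<⇒≤ x<y))
  z≮a = ≤⇒≯ (≤-trans (≮⇒≥ x≮a) (≤-trans (<⇒≤ x<y) y≤z))
rowInsWord-knuth (a ∷ r) (a≤r ∷ sr) (knuth₂ {x} {y} {z} x≤y y<z) with rowInsView x a r
... | bumps x<a _ = rowIns-knuth₂-∷ r x≤y y<z x<a (a≤r ∷ sr)
... | passes x≮a _ =
  rowInsWord-knuth-pass a r sr (knuth₂ x≤y y<z) (x≮a ∷ z≮a ∷ y≮a ∷ []) (z≮a ∷ x≮a ∷ y≮a ∷ [])
  where
  y≮a = ≤⇒≯ (≤-trans (≮⇒≥ x≮a) x≤y)
  z≮a = ≤⇒≯ (≤-trans (≮⇒≥ x≮a) (≤-trans x≤y (<⇒≤ y<z)))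

insertWord-[]-row : ∀ {w w′} → rowInsWord w [] ≡ rowInsWord w′ [] →
  insertWord w ([] ∷ []) ≡ insertWord w′ ([] ∷ [])
insertWord-[]-row {w} {w′} e = begin
  insertWord w ([] ∷ [])
    ≡⟨ insertWord-∷ w [] [] ⟩
  proj₁ (rowInsWord w []) ∷ insertWord (proj₂ (rowInsWord w [])) []
    ≡⟨ cong (λ t → proj₁ t ∷ insertWord (proj₂ t) []) e ⟩
  proj₁ (rowInsWord w′ []) ∷ insertWord (proj₂ (rowInsWord w′ [])) []
    ≡⟨ sym (insertWord-∷ w′ [] []) ⟩
  insertWord w′ ([] ∷ []) ∎
  where open ≡-Reasoning

insertWord-knuth : ∀ {w w′} T → All Sorted T → KnuthMove w w′ → insertWord w T ≡ insertWord w′ T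
insertWord-knuth T _ stay = refl
insertWord-knuth {w} {w′} (r ∷ rs) (sr ∷ srs) m with rowInsWord-knuth r sr m
... | same-row , bumped-move rewrite insertWord-∷ w r rs | insertWord-∷ w′ r rs =
  cong₂ _∷_ same-row (insertWord-knuth rs srs bumped-move)
-- A nonempty word is inserted into the empty tableau as into a single empty row.
insertWord-knuth {w} {w′} [] _ m@(knuth₁ _ _) = insertWord-[]-row {w} {w′} (rowInsWord-knuth-[] m)
insertWord-knuth {w} {w′} [] _ m@(knuth₂ _ _) = insertWord-[]-row {w} {w′} (rowInsWord-knuth-[] m)

-- Knuth equivalence

infix 4 _⟶K_ _≈K_

data _⟶K_ : Word → Word → Set where
  inContext : ∀ p s {a b} → KnuthMove a b → (p ++ a ++ s) ⟶K (p ++ b ++ s)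

_≈K_ : Word → Word → Set
_≈K_ = EqClosure _⟶K_

knuth : ∀ p s {a b} → KnuthMove a b → (p ++ a ++ s) ≈K (p ++ b ++ s)
knuth p s m = return (inContext p s m)

≡⇒≈K : ∀ {w w′} → w ≡ w′ → w ≈K w′
≡⇒≈K refl = ε

⟶K-++⁺ˡ : ∀ q {w w′} → w ⟶K w′ → (q ++ w) ⟶K (q ++ w′)
⟶K-++⁺ˡ q (inContext p s {a} {b} m) =
  subst₂ _⟶K_ (++-assoc q p (a ++ s)) (++-assoc q p (b ++ s)) (inContext (q ++ p) s m)

⟶K-++⁺ʳ : ∀ t {w w′} → w ⟶K w′ → (w ++ t) ⟶K (w′ ++ t)
⟶K-++⁺ʳ t (inContext p s {a} {b} m) = subst₂ _⟶K_ (sym (assoc a)) (sym (assoc b)) (inContext p (s ++ t) m)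
  where
  assoc : ∀ c → (p ++ c ++ s) ++ t ≡ p ++ c ++ (s ++ t)
  assoc c = trans (++-assoc p (c ++ s) t) (cong (p ++_) (++-assoc c s t))

≈K-++⁺ˡ : ∀ q {w w′} → w ≈K w′ → (q ++ w) ≈K (q ++ w′)
≈K-++⁺ˡ q = gmap (q ++_) (⟶K-++⁺ˡ q)

≈K-++⁺ʳ : ∀ t {w w′} → w ≈K w′ → (w ++ t) ≈K (w′ ++ t)
≈K-++⁺ʳ t = gmap (_++ t) (⟶K-++⁺ʳ t)

P-⟶K : ∀ {w w′} → w ⟶K w′ → P w ≡ P w′
P-⟶K (inContext p s {a} {b} m) = begin
  P (p ++ a ++ s)                    ≡⟨ P-++ p (a ++ s) ⟩
  insertWord (a ++ s) (P p)          ≡⟨ foldl-++ (λ T x → insertT x T) (P p) a s ⟩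
  insertWord s (insertWord a (P p))  ≡⟨ cong (insertWord s) (insertWord-knuth (P p) (P-sorted p) m) ⟩
  insertWord s (insertWord b (P p))  ≡⟨ sym (foldl-++ (λ T x → insertT x T) (P p) b s) ⟩
  insertWord (b ++ s) (P p)          ≡⟨ sym (P-++ p (b ++ s)) ⟩
  P (p ++ b ++ s)                    ∎
  where open ≡-Reasoning

≈K⇒P≡ : ∀ {w w′} → w ≈K w′ → P w ≡ P w′
≈K⇒P≡ = gfold ≡.isEquivalence P P-⟶K

-- Reading words

reading : Tableau → Word
reading [] = []
reading (r ∷ rs) = reading rs ++ r

sorted-∷ʳ-≈K : ∀ x a r → x < a → Sorted (a ∷ r) → (a ∷ r ++ [ x ]) ≈K (a ∷ x ∷ r)
sorted-∷ʳ-≈K x a [] _ _ = ε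
sorted-∷ʳ-≈K x a (b ∷ r) x<a ((a≤b ∷ _) ∷ sr) =
  ≈K-++⁺ˡ [ a ] (sorted-∷ʳ-≈K x b r (<-≤-trans x<a a≤b) sr) ◅◅ knuth [] r (knuth₁ x<a a≤b)

rowIns-≈K : ∀ x r {y} → Sorted r → bumped x r ≡ just y → (r ++ [ x ]) ≈K (y ∷ newRow x r)
rowIns-≈K x (a ∷ r) {y} (a≤r ∷ sr) eb with rowInsView x a r
... | bumps x<a e rewrite e | just-injective eb = sorted-∷ʳ-≈K x y r x<a (a≤r ∷ sr)
... | passes x≮a e rewrite e with newRow-head x r | ∈-newRow⁻ x r {proj₁ (newRow-head x r)}
...   | c , rest , nr≡ , c≤x | c∈ rewrite nr≡ =
  ≈K-++⁺ˡ [ a ] (subst (λ t → (r ++ [ x ]) ≈K (y ∷ t)) nr≡ (rowIns-≈K x r sr eb))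
    ◅◅ knuth [] rest (knuth₂ a≤c (≤-<-trans c≤x (proj₂ (bumped-just⁻ x r eb))))
  where
  a≤c : a ≤ c
  a≤c with c∈ (here refl)
  ... | inj₁ c∈r = All.lookup a≤r c∈r
  ... | inj₂ refl = ≮⇒≥ x≮a

reading-insertT : ∀ x T → All Sorted T → (reading T ++ [ x ]) ≈K reading (insertT x T)
reading-insertT x [] _ = ε
reading-insertT x (r ∷ rs) (sr ∷ srs) rewrite insertT-∷ x r rs with bumped x r in eb
... | nothing rewrite newRow-nothing x r eb = ≡⇒≈K (++-assoc (reading rs) r [ x ])
... | just y =
  ≡⇒≈K (++-assoc (reading rs) r [ x ])
  ◅◅ ≈K-++⁺ˡ (reading rs) (rowIns-≈K x r sr eb)
  ◅◅ ≡⇒≈K (sym (++-assoc (reading rs) [ y ] (newRow x r)))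
  ◅◅ ≈K-++⁺ʳ (newRow x r) (reading-insertT y rs srs)

reading-insertWord : ∀ w T → All Sorted T → (reading T ++ w) ≈K reading (insertWord w T)
reading-insertWord [] T _ = ≡⇒≈K (++-identityʳ (reading T))
reading-insertWord (x ∷ w) T sT =
  ≡⇒≈K (sym (++-assoc (reading T) [ x ] w))
  ◅◅ ≈K-++⁺ʳ w (reading-insertT x T sT)
  ◅◅ reading-insertWord w (insertT x T) (insertT-sorted x T sT)

P≡⇒≈K : ∀ {w w′} → P w ≡ P w′ → w ≈K w′
P≡⇒≈K {w} {w′} e =
  reading-insertWord w [] [] ◅◅ ≡⇒≈K (cong reading e) ◅◅ symmetric _⟶K_ (reading-insertWord w′ [] [])

KnuthMove⇒↭ : ∀ {a b} → KnuthMove a b → a ↭ b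
KnuthMove⇒↭ stay = ↭-refl
KnuthMove⇒↭ (knuth₁ {x} {y} {z} _ _) = prep y (swap z x ↭-refl)
KnuthMove⇒↭ (knuth₂ {x} {y} {z} _ _) = swap x z ↭-refl

⟶K⇒↭ : ∀ {w w′} → w ⟶K w′ → w ↭ w′
⟶K⇒↭ (inContext p s m) = ++⁺ˡ p (++⁺ʳ s (KnuthMove⇒↭ m))

≈K⇒↭ : ∀ {w w′} → w ≈K w′ → w ↭ w′
≈K⇒↭ = fold ↭-isEquivalence ⟶K⇒↭

module _ {Q : ℕ → Set} (Q? : Decidable Q)
         (convex : ∀ {x y z} → Q x → Q z → x ≤ y → y ≤ z → Q y) where

  filter-∷₃ : ∀ a b c → filter Q? (a ∷ b ∷ c ∷ []) ≡ filter Q? [ a ] ++ filter Q? [ b ] ++ filter Q? [ c ]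
  filter-∷₃ a b c = trans (filter-++ Q? [ a ] ([ b ] ++ [ c ])) (cong (filter Q? [ a ] ++_) (filter-++ Q? [ b ] [ c ]))

  filter-KnuthMove : ∀ {a b} → KnuthMove a b → KnuthMove (filter Q? a) (filter Q? b)
  filter-KnuthMove stay = stay
  filter-KnuthMove (knuth₁ {x} {y} {z} x<y y≤z)
    rewrite filter-∷₃ y z x | filter-∷₃ y x z with Q? x | Q? z | Q? y
  ... | yes _  | yes _  | yes _  = knuth₁ x<y y≤z
  ... | yes qx | yes qz | no ¬qy = ⊥-elim (¬qy (convex qx qz (<⇒≤ x<y) y≤z))
  ... | yes _  | no _   | _      = stay
  ... | no _   | yes _  | _      = stay
  ... | no _   | no _   | _      = stay
  filter-KnuthMove (knuth₂ {x} {y} {z} x≤y y<z)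
    rewrite filter-∷₃ x z y | filter-∷₃ z x y with Q? x | Q? z | Q? y
  ... | yes _  | yes _  | yes _  = knuth₂ x≤y y<z
  ... | yes qx | yes qz | no ¬qy = ⊥-elim (¬qy (convex qx qz x≤y (<⇒≤ y<z)))
  ... | yes _  | no _   | _      = stay
  ... | no _   | yes _  | _      = stay
  ... | no _   | no _   | _      = stay

  filter-⟶K : ∀ {w w′} → w ⟶K w′ → filter Q? w ⟶K filter Q? w′
  filter-⟶K (inContext p s {a} {b} m) =
    subst₂ _⟶K_ (sym (filter-++₃ a)) (sym (filter-++₃ b))
      (inContext (filter Q? p) (filter Q? s) (filter-KnuthMove m))
    where
    filter-++₃ : ∀ c → filter Q? (p ++ c ++ s) ≡ filter Q? p ++ filter Q? c ++ filter Q? s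
    filter-++₃ c = trans (filter-++ Q? p (c ++ s)) (cong (filter Q? p ++_) (filter-++ Q? c s))

  filter-≈K : ∀ {w w′} → w ≈K w′ → filter Q? w ≈K filter Q? w′
  filter-≈K = gmap (filter Q?) filter-⟶K

-- Strictness is only needed on letters satisfying Q: rank w, which defines st w, is strictly
-- monotone only on the letters of w.
module _ (g : ℕ → ℕ) {Q : ℕ → Set}
         (g-mono : ∀ {a b} → a ≤ b → g a ≤ g b)
         (g-strict : ∀ {a b} → Q a → a < b → g a < g b) where

  map-KnuthMove : ∀ {a b} → KnuthMove a b → All Q a → KnuthMove (map g a) (map g b)
  map-KnuthMove stay _ = stay
  map-KnuthMove (knuth₁ x<y y≤z) (_ ∷ _ ∷ qx ∷ []) = knuth₁ (g-strict qx x<y) (g-mono y≤z)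
  map-KnuthMove (knuth₂ x≤y y<z) (_ ∷ _ ∷ qy ∷ []) = knuth₂ (g-mono x≤y) (g-strict qy y<z)

  map-⟶K : ∀ {w w′} → w ⟶K w′ → All Q w → map g w ⟶K map g w′
  map-⟶K (inContext p s {a} {b} m) qw =
    subst₂ _⟶K_ (sym (map-++₃ a)) (sym (map-++₃ b))
      (inContext (map g p) (map g s) (map-KnuthMove m (++⁻ˡ a (++⁻ʳ p qw))))
    where
    map-++₃ : ∀ c → map g (p ++ c ++ s) ≡ map g p ++ map g c ++ map g s
    map-++₃ c = trans (map-++ g p (c ++ s)) (cong (map g p ++_) (map-++ g c s))

  map-≈K : ∀ {w w′} → w ≈K w′ → All Q w → map g w ≈K map g w′
  map-≈K ε _ = ε
  map-≈K (fwd k ◅ ks) qw = fwd (map-⟶K k qw) ◅ map-≈K ks (All-resp-↭ (⟶K⇒↭ k) qw)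
  map-≈K (bwd k ◅ ks) qw = bwd (map-⟶K k qw′) ◅ map-≈K ks qw′
    where qw′ = All-resp-↭ (↭-sym (⟶K⇒↭ k)) qw

InRange : ℕ → ℕ → ℕ → Set
InRange a b x = a ≤ x × x ≤ b

inRange? : ∀ a b → Decidable (InRange a b)
inRange? a b x = (a ≤? x) ×-dec (x ≤? b)

restrict-≈K : ∀ a b {w w′} → w ≈K w′ → restrict a b w ≈K restrict a b w′
restrict-≈K a b = filter-≈K (inRange? a b)
  (λ (a≤x , _) (_ , z≤b) x≤y y≤z → ≤-trans a≤x x≤y , ≤-trans y≤z z≤b)

shiftW-≈K : ∀ p {w w′} → w ≈K w′ → shiftW p w ≈K shiftW p w′
shiftW-≈K p {w} k =
  map-≈K (p +_) {Q = λ _ → ⊤} (+-monoʳ-≤ p) (λ _ → +-monoʳ-< p) k (All.universal (λ _ → tt) w)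

-- st w is definitionally map (rank w) w.
rank : Word → ℕ → ℕ
rank w x = suc (length (filter (_<? x) w))

rank-∷-< : ∀ {y x} w → y < x → rank (y ∷ w) x ≡ suc (rank w x)
rank-∷-< {x = x} w y<x = cong (suc ∘ length) (filter-accept (_<? x) y<x)

rank-∷-≮ : ∀ {y x} w → ¬ y < x → rank (y ∷ w) x ≡ rank w x
rank-∷-≮ {x = x} w y≮x = cong (suc ∘ length) (filter-reject (_<? x) y≮x)

rank-mono : ∀ w {a b} → a ≤ b → rank w a ≤ rank w b
rank-mono [] _ = ≤-refl
rank-mono (y ∷ w) {a} {b} a≤b with y <? a | y <? b
... | yes y<a | yes y<b rewrite rank-∷-< w y<a | rank-∷-< w y<b = s≤s (rank-mono w a≤b)
... | yes y<a | no y≮b  = ⊥-elim (y≮b (<-≤-trans y<a a≤b))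
... | no y≮a  | yes y<b rewrite rank-∷-≮ w y≮a | rank-∷-< w y<b = m≤n⇒m≤1+n (rank-mono w a≤b)
... | no y≮a  | no y≮b  rewrite rank-∷-≮ w y≮a | rank-∷-≮ w y≮b = rank-mono w a≤b

rank-strict : ∀ w {a b} → a ∈ w → a < b → rank w a < rank w b
rank-strict (y ∷ w) {a} {b} (here refl) a<b
  rewrite rank-∷-≮ w (<-irrefl {y} refl) | rank-∷-< w a<b = s≤s (rank-mono w (<⇒≤ a<b))
rank-strict (y ∷ w) {a} {b} (there a∈w) a<b with y <? a | y <? b
... | yes y<a | yes y<b rewrite rank-∷-< w y<a | rank-∷-< w y<b = s≤s (rank-strict w a∈w a<b)
... | yes y<a | no y≮b  = ⊥-elim (y≮b (<-trans y<a a<b))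
... | no y≮a  | yes y<b rewrite rank-∷-≮ w y≮a | rank-∷-< w y<b = m≤n⇒m≤1+n (rank-strict w a∈w a<b)
... | no y≮a  | no y≮b  rewrite rank-∷-≮ w y≮a | rank-∷-≮ w y≮b = rank-strict w a∈w a<b

rank-↭ : ∀ {w w′} → w ↭ w′ → ∀ x → rank w x ≡ rank w′ x
rank-↭ w↭w′ x = cong suc (↭-length (filter-↭ (_<? x) w↭w′))

st-≈K : ∀ {w w′} → w ≈K w′ → st w ≈K st w′
st-≈K {w} {w′} k =
  map-≈K (rank w) {Q = _∈ w} (rank-mono w) (rank-strict w) k (All.tabulate id)
  ◅◅ ≡⇒≈K (map-cong (rank-↭ (≈K⇒↭ k)) w′)

P-st-restrict : ∀ a b w w′ → P w ≡ P w′ → P (st (restrict a b w)) ≡ P (st (restrict a b w′))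
P-st-restrict a b w w′ e = ≈K⇒P≡ (st-≈K (restrict-≈K a b (P≡⇒≈K {w} {w′} e)))

P-triangleʳ : ∀ p v u u′ → P u ≡ P u′ → P (triangle p v u) ≡ P (triangle p v u′)
P-triangleʳ p v u u′ e = ≈K⇒P≡ (≈K-++⁺ˡ (shiftW p v) (P≡⇒≈K {u} {u′} e))

P-triangleˡ : ∀ p u v v′ → P v ≡ P v′ → P (triangle p v u) ≡ P (triangle p v′ u)
P-triangleˡ p u v v′ e = ≈K⇒P≡ (≈K-++⁺ʳ u (shiftW-≈K p (P≡⇒≈K {v} {v′} e)))

interval : ℕ → ℕ → Word
interval m zero = []
interval m (suc n) = suc m ∷ interval (suc m) n

interval-InRange : ∀ m n → All (InRange (suc m) (m + n)) (interval m n)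
interval-InRange m zero = []
interval-InRange m (suc n) =
  (≤-refl , m<m+n m (s≤s z≤n))
  ∷ All.map (λ {c} (m<c , c≤) → <⇒≤ m<c , subst (c ≤_) (sym (+-suc m n)) c≤) (interval-InRange (suc m) n)

applyUpTo-interval : ∀ m n (f : ℕ → ℕ) → (∀ i → f i ≡ suc (m + i)) → applyUpTo f n ≡ interval m n
applyUpTo-interval m zero f f≗ = refl
applyUpTo-interval m (suc n) f f≗ =
  cong₂ _∷_ (trans (f≗ 0) (cong suc (+-identityʳ m)))
            (applyUpTo-interval (suc m) n (f ∘ suc) (λ i → trans (f≗ (suc i)) (cong suc (+-suc m i))))

upTo-interval : ∀ n → map suc (upTo n) ≡ interval 0 n
upTo-interval n = trans (map-upTo suc n) (applyUpTo-interval 0 n suc (λ _ → refl))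

interval-+ : ∀ m p q → interval m (p + q) ≡ interval m p ++ interval (m + p) q
interval-+ m zero q = cong (λ k → interval k q) (sym (+-identityʳ m))
interval-+ m (suc p) q =
  cong (suc m ∷_) (trans (interval-+ (suc m) p q) (cong (λ k → interval (suc m) p ++ interval k q) (sym (+-suc m p))))

shiftW-interval : ∀ p m n → shiftW p (interval m n) ≡ interval (p + m) n
shiftW-interval p m zero = refl
shiftW-interval p m (suc n) =
  cong₂ _∷_ (+-suc p m) (trans (shiftW-interval p (suc m) n) (cong (λ k → interval k n) (+-suc p m)))

IsPerm-InRange : ∀ {n w} → IsPerm n w → All (InRange 1 n) w
IsPerm-InRange {n} w↭ = All-resp-↭ (↭-sym w↭) (subst (All _) (sym (upTo-interval n)) (interval-InRange 0 n))

rank-≤ : ∀ {c} w → All (c ≤_) w → rank w c ≡ 1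
rank-≤ {c} w c≤w = cong (suc ∘ length) (filter-none (_<? c) (All.map ≤⇒≯ c≤w))

rank-interval : ∀ m n {c} → InRange (suc m) (m + n) c → rank (interval m n) c ≡ c ∸ m
rank-interval m zero (m<c , c≤m+0) = ⊥-elim (<⇒≱ m<c (subst (_ ≤_) (+-identityʳ m) c≤m+0))
rank-interval m (suc n) {suc c} (s≤s m≤c , c≤) with suc m <? suc c
... | yes sm<sc rewrite rank-∷-< (interval (suc m) n) sm<sc = begin
  suc (rank (interval (suc m) n) (suc c))
    ≡⟨ cong suc (rank-interval (suc m) n (sm<sc , subst (suc c ≤_) (+-suc m n) c≤)) ⟩
  suc (c ∸ m)
    ≡⟨ +-∸-assoc 1 m≤c ⟨
  suc c ∸ m ∎
  where open ≡-Reasoning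
... | no sm≮sc rewrite rank-∷-≮ (interval (suc m) n) sm≮sc | ≤-antisym m≤c (≮⇒≥ (sm≮sc ∘ s≤s)) =
  trans (rank-≤ (interval (suc c) n) (All.map (<⇒≤ ∘ proj₁) (interval-InRange (suc c) n)))
        (sym (trans (+-∸-assoc 1 {c} ≤-refl) (cong suc (n∸n≡0 c))))

st-interval : ∀ m n {w} → w ↭ interval m n → st w ≡ map (_∸ m) w
st-interval m n {w} w↭ = map-cong-local (All.map rank≡ (All-resp-↭ (↭-sym w↭) (interval-InRange m n)))
  where
  rank≡ : ∀ {c} → InRange (suc m) (m + n) c → rank w c ≡ c ∸ m
  rank≡ {c} c∈ = trans (rank-↭ w↭ c) (rank-interval m n c∈)

st-IsPerm : ∀ {n w} → IsPerm n w → st w ≡ w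
st-IsPerm {n} {w} w↭ = trans (st-interval 0 n (↭-trans w↭ (↭-reflexive (upTo-interval n)))) (map-id w)

↭interval⇒IsPerm : ∀ {n w} → w ↭ interval 0 n → IsPerm n w
↭interval⇒IsPerm {n} w↭ = ↭-trans w↭ (↭-reflexive (sym (upTo-interval n)))

IsPerm⇒↭interval : ∀ {n w} → IsPerm n w → w ↭ interval 0 n
IsPerm⇒↭interval {n} w↭ = ↭-trans w↭ (↭-reflexive (upTo-interval n))

interval-shiftW : ∀ p n → interval p n ≡ shiftW p (interval 0 n)
interval-shiftW p n = trans (cong (λ k → interval k n) (sym (+-identityʳ p))) (sym (shiftW-interval p 0 n))

unshift-shiftW : ∀ p xs → map (_∸ p) (shiftW p xs) ≡ xs
unshift-shiftW p xs = trans (sym (map-∘ xs)) (trans (map-cong (m+n∸m≡n p) xs) (map-id xs))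

IsPerm-shiftW : ∀ p {q v} → IsPerm q v → shiftW p v ↭ interval p q
IsPerm-shiftW p {q} v↭ = ↭-trans (map⁺ (p +_) (IsPerm⇒↭interval v↭)) (↭-reflexive (sym (interval-shiftW p q)))

IsPerm-triangle : ∀ p q {u v} → IsPerm p u → IsPerm q v → IsPerm (p + q) (triangle p v u)
IsPerm-triangle p q {u} {v} u↭ v↭ = ↭interval⇒IsPerm (begin
  triangle p v u               ↭⟨ ++⁺ (IsPerm-shiftW p v↭) (IsPerm⇒↭interval u↭) ⟩
  interval p q ++ interval 0 p ↭⟨ ++-comm (interval p q) (interval 0 p) ⟩
  interval 0 p ++ interval p q ≡⟨ interval-+ 0 p q ⟨
  interval 0 (p + q)           ∎)
  where open ↭.PermutationReasoning

restrict-keepˡ : ∀ a b {xs ys} → All (InRange a b) xs → All (¬_ ∘ InRange a b) ys →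
  restrict a b (xs ++ ys) ≡ xs
restrict-keepˡ a b {xs} {ys} xs∈ ys∉
  rewrite filter-++ (inRange? a b) xs ys | filter-all (inRange? a b) xs∈ | filter-none (inRange? a b) ys∉
  = ++-identityʳ xs

restrict-keepʳ : ∀ a b {xs ys} → All (¬_ ∘ InRange a b) xs → All (InRange a b) ys →
  restrict a b (xs ++ ys) ≡ ys
restrict-keepʳ a b {xs} {ys} xs∉ ys∈
  rewrite filter-++ (inRange? a b) xs ys | filter-none (inRange? a b) xs∉ | filter-all (inRange? a b) ys∈
  = refl

module _ (p q : ℕ) where

  low⇒¬high : ∀ {x} → InRange 1 p x → ¬ InRange (suc p) (p + q) x
  low⇒¬high (_ , x≤p) (p<x , _) = <⇒≱ p<x x≤p

  high⇒¬low : ∀ {x} → InRange (suc p) (p + q) x → ¬ InRange 1 p x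
  high⇒¬low x∈ x∈′ = low⇒¬high x∈′ x∈

  restrict-low-↭ : ∀ {σ} → IsPerm (p + q) σ → restrict 1 p σ ↭ interval 0 p
  restrict-low-↭ σ↭ = ↭-trans (filter-↭ (inRange? 1 p) (IsPerm⇒↭interval σ↭)) (↭-reflexive (begin
    restrict 1 p (interval 0 (p + q))
      ≡⟨ cong (restrict 1 p) (interval-+ 0 p q) ⟩
    restrict 1 p (interval 0 p ++ interval p q)
      ≡⟨ restrict-keepˡ 1 p (interval-InRange 0 p) (All.map high⇒¬low (interval-InRange p q)) ⟩
    interval 0 p ∎))
    where open ≡-Reasoning

  restrict-high-↭ : ∀ {σ} → IsPerm (p + q) σ → restrict (suc p) (p + q) σ ↭ interval p q
  restrict-high-↭ σ↭ =
    ↭-trans (filter-↭ (inRange? (suc p) (p + q)) (IsPerm⇒↭interval σ↭)) (↭-reflexive (begin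
    restrict (suc p) (p + q) (interval 0 (p + q))
      ≡⟨ cong (restrict (suc p) (p + q)) (interval-+ 0 p q) ⟩
    restrict (suc p) (p + q) (interval 0 p ++ interval p q)
      ≡⟨ restrict-keepʳ (suc p) (p + q) (All.map low⇒¬high (interval-InRange 0 p)) (interval-InRange p q) ⟩
    interval p q ∎))
    where open ≡-Reasoning

  IsPerm-st-low : ∀ {σ} → IsPerm (p + q) σ → IsPerm p (st (restrict 1 p σ))
  IsPerm-st-low σ↭ = subst (IsPerm p) (sym (st-IsPerm low↭)) low↭
    where low↭ = ↭interval⇒IsPerm (restrict-low-↭ σ↭)

  IsPerm-st-high : ∀ {σ} → IsPerm (p + q) σ → IsPerm q (st (restrict (suc p) (p + q) σ))
  IsPerm-st-high {σ} σ↭ rewrite st-interval p q (restrict-high-↭ σ↭) =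
    ↭interval⇒IsPerm (↭-trans (map⁺ (_∸ p) (restrict-high-↭ σ↭))
      (↭-reflexive (trans (cong (map (_∸ p)) (interval-shiftW p q)) (unshift-shiftW p (interval 0 q)))))

  high++low≡triangle : ∀ {σ} → IsPerm (p + q) σ →
    restrict (suc p) (p + q) σ ++ restrict 1 p σ ≡
    triangle p (st (restrict (suc p) (p + q) σ)) (st (restrict 1 p σ))
  high++low≡triangle {σ} σ↭ =
    sym (cong₂ _++_ shift-st-high (st-IsPerm (↭interval⇒IsPerm (restrict-low-↭ σ↭))))
    where
    high = restrict (suc p) (p + q) σ
    shift-st-high : shiftW p (st high) ≡ high
    shift-st-high rewrite st-interval p q (restrict-high-↭ σ↭) =
      trans (sym (map-∘ high))
        (map-id-local (All.map (λ (p<x , _) → m+[n∸m]≡n (<⇒≤ p<x))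
                               (All-resp-↭ (↭-sym (restrict-high-↭ σ↭)) (interval-InRange p q))))

  module _ {u v} (u↭ : IsPerm p u) (v↭ : IsPerm q v) where

    shiftW-high : All (InRange (suc p) (p + q)) (shiftW p v)
    shiftW-high = All-resp-↭ (↭-sym (IsPerm-shiftW p v↭)) (interval-InRange p q)

    st-restrict-low-triangle : st (restrict 1 p (triangle p v u)) ≡ u
    st-restrict-low-triangle
      rewrite restrict-keepʳ 1 p (All.map high⇒¬low shiftW-high) (IsPerm-InRange u↭) = st-IsPerm u↭

    st-restrict-high-triangle : st (restrict (suc p) (p + q) (triangle p v u)) ≡ v
    st-restrict-high-triangle
      rewrite restrict-keepˡ (suc p) (p + q) shiftW-high (All.map low⇒¬high (IsPerm-InRange u↭))
            | st-interval p q (IsPerm-shiftW p v↭) = unshift-shiftW p v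

-- The right weak order

Before-∈ : ∀ {w a b} → Before w a b → a ∈ w × b ∈ w
Before-∈ (here b∈w) = here refl , there b∈w
Before-∈ (there bf) with Before-∈ bf
... | a∈w , b∈w = there a∈w , there b∈w

Before-++⁺ˡ : ∀ {xs a b} ys → Before xs a b → Before (xs ++ ys) a b
Before-++⁺ˡ ys (here b∈xs) = here (∈-++⁺ˡ b∈xs)
Before-++⁺ˡ ys (there bf) = there (Before-++⁺ˡ ys bf)

Before-++⁺ʳ : ∀ xs {ys a b} → Before ys a b → Before (xs ++ ys) a b
Before-++⁺ʳ [] bf = bf
Before-++⁺ʳ (x ∷ xs) bf = there (Before-++⁺ʳ xs bf)

Before-++⁺ : ∀ {xs ys a b} → a ∈ xs → b ∈ ys → Before (xs ++ ys) a b
Before-++⁺ {x ∷ xs} (here refl) b∈ys = here (∈-++⁺ʳ xs b∈ys)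
Before-++⁺ {x ∷ xs} (there a∈xs) b∈ys = there (Before-++⁺ a∈xs b∈ys)

Before-++⁻ : ∀ xs {ys a b} → Before (xs ++ ys) a b →
  Before xs a b ⊎ (a ∈ xs × b ∈ ys) ⊎ Before ys a b
Before-++⁻ [] bf = inj₂ (inj₂ bf)
Before-++⁻ (x ∷ xs) (here b∈) with ∈-++⁻ xs b∈
... | inj₁ b∈xs = inj₁ (here b∈xs)
... | inj₂ b∈ys = inj₂ (inj₁ (here refl , b∈ys))
Before-++⁻ (x ∷ xs) (there bf) with Before-++⁻ xs bf
... | inj₁ bf′ = inj₁ (there bf′)
... | inj₂ (inj₁ (a∈xs , b∈ys)) = inj₂ (inj₁ (there a∈xs , b∈ys))
... | inj₂ (inj₂ bf′) = inj₂ (inj₂ bf′)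

Before-map⁺ : ∀ (f : ℕ → ℕ) {w a b} → Before w a b → Before (map f w) (f a) (f b)
Before-map⁺ f (here b∈w) = here (∈-map⁺ f b∈w)
Before-map⁺ f (there bf) = there (Before-map⁺ f bf)

Before-map⁻ : ∀ (f : ℕ → ℕ) w {c d} → Before (map f w) c d →
  ∃ λ a → ∃ λ b → f a ≡ c × f b ≡ d × Before w a b
Before-map⁻ f (x ∷ w) (here d∈) with ∈-map⁻ f d∈
... | b , b∈w , refl = x , b , refl , refl , here b∈w
Before-map⁻ f (x ∷ w) (there bf) with Before-map⁻ f w bf
... | a , b , fa≡c , fb≡d , bf′ = a , b , fa≡c , fb≡d , there bf′

module _ {Q : ℕ → Set} (Q? : Decidable Q) where

  Before-filter⁺ : ∀ {w a b} → Q a → Q b → Before w a b → Before (filter Q? w) a b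
  Before-filter⁺ {x ∷ w} qa qb (here b∈w) rewrite filter-accept Q? {x} {w} qa = here (∈-filter⁺ Q? b∈w qb)
  Before-filter⁺ {x ∷ w} qa qb (there bf) with Q? x
  ... | yes _ = there (Before-filter⁺ qa qb bf)
  ... | no _ = Before-filter⁺ qa qb bf

  Before-filter⁻ : ∀ {w a b} → Before (filter Q? w) a b → Before w a b
  Before-filter⁻ {x ∷ w} bf with Q? x
  Before-filter⁻ {x ∷ w} (here b∈) | yes _ = here (proj₁ (∈-filter⁻ Q? b∈))
  Before-filter⁻ {x ∷ w} (there bf) | yes _ = there (Before-filter⁻ bf)
  ... | no _ = there (Before-filter⁻ bf)

  WeakLe-filter : ∀ {s t} → WeakLe s t → WeakLe (filter Q? s) (filter Q? t)
  WeakLe-filter {s} {t} s≤t j i (i<j , bf) =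
    i<j , Before-filter⁺ (proj₂ (∈-filter⁻ Q? {xs = s} j∈)) (proj₂ (∈-filter⁻ Q? {xs = s} i∈))
            (proj₂ (s≤t j i (i<j , Before-filter⁻ bf)))
    where
    j∈ = proj₁ (Before-∈ bf)
    i∈ = proj₂ (Before-∈ bf)

WeakLe-++⁺ˡ : ∀ xs {u u′} → u ↭ u′ → WeakLe u u′ → WeakLe (xs ++ u) (xs ++ u′)
WeakLe-++⁺ˡ xs u↭u′ u≤u′ j i (i<j , bf) with Before-++⁻ xs bf
... | inj₁ bf′ = i<j , Before-++⁺ˡ _ bf′
... | inj₂ (inj₁ (j∈xs , i∈u)) = i<j , Before-++⁺ j∈xs (∈-resp-↭ u↭u′ i∈u)
... | inj₂ (inj₂ bf′) = i<j , Before-++⁺ʳ xs (proj₂ (u≤u′ j i (i<j , bf′)))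

WeakLe-++⁺ʳ : ∀ ys {v v′} → v ↭ v′ → WeakLe v v′ → WeakLe (v ++ ys) (v′ ++ ys)
WeakLe-++⁺ʳ ys {v} {v′} v↭v′ v≤v′ j i (i<j , bf) with Before-++⁻ v bf
... | inj₁ bf′ = i<j , Before-++⁺ˡ ys (proj₂ (v≤v′ j i (i<j , bf′)))
... | inj₂ (inj₁ (j∈v , i∈ys)) = i<j , Before-++⁺ (∈-resp-↭ v↭v′ j∈v) i∈ys
... | inj₂ (inj₂ bf′) = i<j , Before-++⁺ʳ v′ bf′

WeakLe-shiftW : ∀ p {v v′} → WeakLe v v′ → WeakLe (shiftW p v) (shiftW p v′)
WeakLe-shiftW p {v} v≤v′ j i (i<j , bf) with Before-map⁻ (p +_) v bf
... | a , b , refl , refl , bf′ =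
  i<j , Before-map⁺ (p +_) (proj₂ (v≤v′ a b (+-cancelˡ-< p b a i<j , bf′)))

-- Standardization only relabels letters in an order-preserving way.
WeakLe-st : ∀ {s t} → s ↭ t → WeakLe s t → WeakLe (st s) (st t)
WeakLe-st {s} {t} s↭t s≤t j i (i<j , bf) with Before-map⁻ (rank s) s bf
... | x , y , refl , refl , bf′ =
  i<j , subst₂ (Before (st t)) (sym (rank-↭ s↭t x)) (sym (rank-↭ s↭t y))
          (Before-map⁺ (rank t) (proj₂ (s≤t x y (y<x , bf′))))
  where
  y<x : y < x
  y<x = ≰⇒> (λ x≤y → <⇒≱ i<j (rank-mono s x≤y))

WeakLe-st-restrict : ∀ a b {s t} → s ↭ t → WeakLe s t → WeakLe (st (restrict a b s)) (st (restrict a b t))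
WeakLe-st-restrict a b s↭t s≤t = WeakLe-st (filter-↭ (inRange? a b) s↭t) (WeakLe-filter (inRange? a b) s≤t)

WeakLe-high++low : ∀ p q {σ} → IsPerm (p + q) σ →
  WeakLe σ (restrict (suc p) (p + q) σ ++ restrict 1 p σ)
WeakLe-high++low p q {σ} σ↭ j i (i<j , bf) = i<j , before
  where
  j∈ = proj₁ (Before-∈ bf)
  i∈ = proj₂ (Before-∈ bf)
  1≤j = proj₁ (All.lookup (IsPerm-InRange σ↭) j∈)
  1≤i = proj₁ (All.lookup (IsPerm-InRange σ↭) i∈)
  j≤p+q = proj₂ (All.lookup (IsPerm-InRange σ↭) j∈)
  i≤p+q = proj₂ (All.lookup (IsPerm-InRange σ↭) i∈)
  before : Before (restrict (suc p) (p + q) σ ++ restrict 1 p σ) j i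
  before with p <? j | p <? i
  ... | no j≮p | _ = Before-++⁺ʳ (restrict (suc p) (p + q) σ)
    (Before-filter⁺ (inRange? 1 p) (1≤j , ≮⇒≥ j≮p) (1≤i , ≤-trans (<⇒≤ i<j) (≮⇒≥ j≮p)) bf)
  ... | yes p<j | no p≮i = Before-++⁺ (∈-filter⁺ (inRange? (suc p) (p + q)) j∈ (p<j , j≤p+q))
                                      (∈-filter⁺ (inRange? 1 p) i∈ (1≤i , ≮⇒≥ p≮i))
  ... | yes p<j | yes p<i = Before-++⁺ˡ (restrict 1 p σ)
    (Before-filter⁺ (inRange? (suc p) (p + q)) (p<j , j≤p+q) (p<i , i≤p+q) bf)

module _ {m m′} (F : Word → Word)
         (F-mono : ∀ {a b} → a ↭ b → WeakLe a b → WeakLe (F a) (F b))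
         (F-perm : ∀ {a} → IsPerm m a → IsPerm m′ (F a))
         (F-P : ∀ a b → P a ≡ P b → P (F a) ≡ P (F b)) where

  TaskinStep-map : ∀ {X Y x y} → TaskinStep m X Y → P x ≡ X → P y ≡ Y → TaskinStep m′ (P (F x)) (P (F y))
  TaskinStep-map (a , b , a↭ , b↭ , a≤b , Pa≡ , Pb≡) Px≡ Py≡ =
    F a , F b , F-perm a↭ , F-perm b↭ , F-mono (↭-trans a↭ (↭-sym b↭)) a≤b ,
    F-P a _ (trans Pa≡ (sym Px≡)) , F-P b _ (trans Pb≡ (sym Py≡))

  TaskinLe-map : ∀ x y → TaskinLe m (P x) (P y) → TaskinLe m′ (P (F x)) (P (F y))
  TaskinLe-map _ _ x≤y = go x≤y refl refl
    where
    go : ∀ {X Y x y} → TaskinLe m X Y → P x ≡ X → P y ≡ Y → TaskinLe m′ (P (F x)) (P (F y))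
    go TC.[ s ] Px≡ Py≡ = TC.[ TaskinStep-map s Px≡ Py≡ ]
    go (s@(_ , b , _ , _ , _ , _ , Pb≡) ∷ rest) Px≡ Py≡ =
      TaskinStep-map {y = b} s Px≡ Pb≡ ∷ go rest Pb≡ Py≡

module _ (p q : ℕ) where

  TaskinLe-st-low : ∀ x y → TaskinLe (p + q) (P x) (P y) →
    TaskinLe p (P (st (restrict 1 p x))) (P (st (restrict 1 p y)))
  TaskinLe-st-low =
    TaskinLe-map (st ∘ restrict 1 p) (WeakLe-st-restrict 1 p) (IsPerm-st-low p q) (P-st-restrict 1 p)

  TaskinLe-st-high : ∀ x y → TaskinLe (p + q) (P x) (P y) →
    TaskinLe q (P (st (restrict (suc p) (p + q) x))) (P (st (restrict (suc p) (p + q) y)))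
  TaskinLe-st-high =
    TaskinLe-map (st ∘ restrict (suc p) (p + q)) (WeakLe-st-restrict (suc p) (p + q)) (IsPerm-st-high p q)
                 (P-st-restrict (suc p) (p + q))

  TaskinLe-triangleʳ : ∀ {v} → IsPerm q v → ∀ x y → TaskinLe p (P x) (P y) →
    TaskinLe (p + q) (P (triangle p v x)) (P (triangle p v y))
  TaskinLe-triangleʳ {v} v↭ =
    TaskinLe-map (triangle p v) (WeakLe-++⁺ˡ (shiftW p v)) (λ x↭ → IsPerm-triangle p q x↭ v↭)
                 (P-triangleʳ p v)

  TaskinLe-triangleˡ : ∀ {u} → IsPerm p u → ∀ x y → TaskinLe q (P x) (P y) →
    TaskinLe (p + q) (P (triangle p x u)) (P (triangle p y u))
  TaskinLe-triangleˡ {u} u↭ =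
    TaskinLe-map (λ y → triangle p y u) (λ y↭ y≤ → WeakLe-++⁺ʳ u (map⁺ (p +_) y↭) (WeakLe-shiftW p y≤))
                 (IsPerm-triangle p q u↭) (P-triangleˡ p u)

  TaskinStep-high++low : ∀ {σ} → IsPerm (p + q) σ →
    TaskinStep (p + q) (P σ) (P (triangle p (st (restrict (suc p) (p + q) σ)) (st (restrict 1 p σ))))
  TaskinStep-high++low {σ} σ↭ =
    σ , _ , σ↭ , IsPerm-triangle p q (IsPerm-st-low p q σ↭) (IsPerm-st-high p q σ↭) ,
    subst (WeakLe σ) (high++low≡triangle p q σ↭) (WeakLe-high++low p q σ↭) , refl , refl

lemma5p1 : (p q : ℕ) (Σt : Tableau) → IsSYT (p + q) Σt →
    (σ : Word) → IsPerm (p + q) σ → P σ ≡ Σt →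
    (U V : Tableau) → IsSYT p U → IsSYT q V →
    (u v : Word) → IsPerm p u → IsPerm q v → P u ≡ U → P v ≡ V →
    TaskinLe (p + q) Σt (P (triangle p v u)) ⇔
      (TaskinLe p (P (st (restrict 1 p σ))) U ×
       TaskinLe q (P (st (restrict (suc p) (p + q) σ))) V)
lemma5p1 p q _ _ σ σ↭ refl _ _ _ _ u v u↭ v↭ refl refl = mk⇔ restrictions triangle-chain
  where
  a = st (restrict 1 p σ)
  b = st (restrict (suc p) (p + q) σ)

  restrictions : TaskinLe (p + q) (P σ) (P (triangle p v u)) → TaskinLe p (P a) (P u) × TaskinLe q (P b) (P v)
  restrictions σ≤vu =
    subst (TaskinLe p (P a)) (cong P (st-restrict-low-triangle p q u↭ v↭))
          (TaskinLe-st-low p q σ (triangle p v u) σ≤vu) ,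
    subst (TaskinLe q (P b)) (cong P (st-restrict-high-triangle p q u↭ v↭))
          (TaskinLe-st-high p q σ (triangle p v u) σ≤vu)

  triangle-chain : TaskinLe p (P a) (P u) × TaskinLe q (P b) (P v) → TaskinLe (p + q) (P σ) (P (triangle p v u))
  triangle-chain (a≤u , b≤v) =
    TaskinStep-high++low p q σ↭
    ∷ (TaskinLe-triangleʳ p q (IsPerm-st-high p q σ↭) a u a≤u ⁺++ TaskinLe-triangleˡ p q u↭ b v b≤v)
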